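{- If $A$ is a strongly isolated $r$-by-$n$ $(0,1,\ast)$-matrix, then $\mathrm{opt}(A)\leq 2^{n-r}$.
   Context: A $(0,1,\ast)$-matrix has entries in $\{0,1,\ast\}$; arithmetic is over $GF_2$. For an $r$-by-$n$ $A=(a_{ij})$, let $\mathbf{a}_i$ be the $i$th row with all stars set to $0$, and $D_i$ the diagonal $n$-by-$n$ $(0,1)$-matrix whose $j$th diagonal entry is $1$ iff $a_{ij}=\ast$. $A$ is strongly isolated if there exist $\mathbf{z}_1,\dots,\mathbf{z}_r\in\{0,1\}^n$ such that for all $1\leq i\leq r$: $D_1\mathbf{z}_i=\cdots=D_i\mathbf{z}_i=\mathbf{0}$, $\langle\mathbf{a}_i,\mathbf{z}_i\rangle=1$, and $\langle\mathbf{a}_j,\mathbf{z}_i\rangle=0$ for all $j<i$. A completion of $A$ is obtained by replacing each $\ast$ by $0$ or $1$; an operator $G=(g_1,\dots,g_r)$ is consistent with $A$ if each $g_i$ depends only on variables $x_j$ with $a_{ij}=\ast$; a set $L\subseteq\{0,1\}^n$ is a solution for $A$ if for some completion $M$ and consistent $G$, $M\mathbf{x}=G(\mathbf{x})$ for all $\mathbf{x}\in L$; $\mathrm{opt}(A)$ is the maximum size of a solution. -}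

module Defs where

open import Data.Nat using (ℕ; zero; suc)
open import Data.Bool using (Bool; true; false; _∧_; _xor_)
open import Data.Fin using (Fin; zero; suc) renaming (_≤_ to _≤ᶠ_; _<_ to _<ᶠ_)
open import Data.Vec using (Vec; lookup)
open import Data.List using (List)
open import Data.List.Relation.Unary.All using (All)
open import Data.Product using (Σ; _×_; ∃)
open import Relation.Binary.PropositionalEquality using (_≡_)

data Entry : Set where
  𝟘 𝟙 ⋆ : Entry

Matrix : ℕ → ℕ → Set
Matrix r n = Fin r → Fin n → Entry

val : Entry → Bool
val 𝟘 = false
val 𝟙 = true
val ⋆ = false

row : ∀ {r n} → Matrix r n → Fin r → Fin n → Bool
row A i j = val (A i j)

dot : ∀ {n} → (Fin n → Bool) → (Fin n → Bool) → Bool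
dot {zero}  a z = false
dot {suc n} a z = (a zero ∧ z zero) xor dot (λ j → a (suc j)) (λ j → z (suc j))

-- D_k z = 0 : z vanishes on the star positions of row k.
DZero : ∀ {r n} → Matrix r n → Fin r → (Fin n → Bool) → Set
DZero A k z = ∀ j → A k j ≡ ⋆ → z j ≡ false

StronglyIsolated : ∀ {r n} → Matrix r n → Set
StronglyIsolated {r} {n} A =
  Σ (Fin r → Fin n → Bool) λ z → ∀ i →
      (∀ k → k ≤ᶠ i → DZero A k (z i))
    × (dot (row A i) (z i) ≡ true)
    × (∀ k → k <ᶠ i → dot (row A k) (z i) ≡ false)

Completion : ∀ {r n} → Matrix r n → (Fin r → Fin n → Bool) → Set
Completion A M = ∀ i j → (A i j ≡ 𝟘 → M i j ≡ false) × (A i j ≡ 𝟙 → M i j ≡ true)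

Consistent : ∀ {r n} → Matrix r n → (Fin r → Vec Bool n → Bool) → Set
Consistent {r} {n} A G = ∀ i (x y : Vec Bool n) →
  (∀ j → A i j ≡ ⋆ → lookup x j ≡ lookup y j) → G i x ≡ G i y

IsSolution : ∀ {r n} → Matrix r n → List (Vec Bool n) → Set
IsSolution {r} {n} A L =
  Σ (Fin r → Fin n → Bool) λ M → Σ (Fin r → Vec Bool n → Bool) λ G →
    Completion A M × Consistent A G ×
    All (λ x → ∀ i → dot (M i) (lookup x) ≡ G i x) L

-- For a solution x and coefficients u ∈ {0,1}^r consider the translate x + Σₖ uₖ zₖ.
-- Two solutions never differ by a non-trivial combination w of the zₖ: if i is the least
-- index with uᵢ = 1, then w vanishes on the stars of row i (zₖ does for k ≥ i), so the
-- right-hand side gᵢ is the same at both solutions, while ⟨aᵢ, w⟩ = 1 by isolation, so the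
-- left-hand side ⟨mᵢ, ·⟩ of the i-th equation differs. Hence the |L| · 2^r translates are
-- pairwise distinct vectors of {0,1}^n, and |L| · 2^r ≤ 2^n.
module Submission where

open import Defs
open import Data.Nat using (ℕ; _≤_; _^_; _∸_)
open import Data.Bool using (Bool)
open import Data.Vec using (Vec)
open import Data.List using (List; length)
open import Data.List.Relation.Unary.Unique.Propositional using (Unique)

open import Algebra.Bundles using (CommutativeRing)
open import Data.Nat using (zero; suc; _*_; _<_; z≤n; s≤s)
open import Data.Nat.Properties
  using (≤-trans; m≤m+n; <⇒≱; ≰⇒>; ≮⇒≥; *-cancelʳ-≤; m^n≢0; ^-monoʳ-<; ^-distribˡ-+-*; m∸n+n≡m)
  renaming (_≤?_ to _ℕ≤?_)
open import Data.Bool using (true; false; not; _∧_; _xor_)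
open import Data.Bool.Properties
  using (xor-∧-commutativeRing; ∧-distribˡ-xor; ∧-distribʳ-xor; ∧-zeroʳ; ∧-assoc; ∧-comm;
         xor-assoc; xor-comm; xor-same; xor-identityʳ; true-xor; not-¬)
open import Data.Fin using (Fin; zero; suc; combine; remQuot; funToFin; finToFun; _<?_)
  renaming (_≤_ to _≤ᶠ_; _<_ to _<ᶠ_)
open import Data.Fin.Properties
  using (2↔Bool; funToFin-finToFin; finToFun-funToFin; combine-remQuot; punchInᵢ≢i; <-cmp;
         injective⇒≤)
open import Data.Fin.Induction using (<-wellFounded)
open import Data.Vec.Functional using (Vector; zipWith; removeAt)
open import Data.Vec using (lookup; tabulate)
open import Data.Vec.Properties using (tabulate∘lookup; tabulate-cong)
import Data.List as List
open import Data.List.Membership.Propositional.Properties using (∈-lookup)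
import Data.List.Relation.Unary.All as All
open import Data.List.Relation.Unary.AllPairs using (_∷_)
open import Data.Product using (_×_; _,_; proj₁; proj₂; uncurry)
open import Data.Product.Properties using (×-≡,≡→≡)
open import Function using (_∘_; Inverse)
import Induction.WellFounded as WF
open import Level using (0ℓ)
open import Data.Empty using (⊥; ⊥-elim)
open import Relation.Binary using (tri<; tri≈; tri>)
open import Relation.Binary.PropositionalEquality
open import Relation.Nullary using (yes; no; contradiction)

open import Algebra.Properties.Semiring.Sum (CommutativeRing.semiring xor-∧-commutativeRing)
  using (sum; sum-syntax; sum-cong-≗; sum-replicate-zero; ∑-distrib-+; ∑-comm; sum-remove;
         *-distribˡ-sum)
open import Algebra.Properties.Group (CommutativeRing.+-group xor-∧-commutativeRing)
  using (x∙y⁻¹≈ε⇒x≈y)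

open ≡-Reasoning

infixl 6 _⊕_

_⊕_ : ∀ {n} → Vector Bool n → Vector Bool n → Vector Bool n
_⊕_ = zipWith _xor_

linComb : ∀ {r n} → Vector Bool r → (Fin r → Vector Bool n) → Vector Bool n
linComb {r} u z j = ∑[ k < r ] (u k ∧ z k j)

∑-zero : ∀ {n} {f : Vector Bool n} → (∀ k → f k ≡ false) → sum f ≡ false
∑-zero {n} f≗0 = trans (sum-cong-≗ f≗0) (sum-replicate-zero n)

∑-single : ∀ {n} {f : Vector Bool n} i → (∀ k → k ≢ i → f k ≡ false) → sum f ≡ f i
∑-single {suc n} {f} i off = begin
  sum f                         ≡⟨ sum-remove {i = i} f ⟩
  f i xor sum (removeAt f i)    ≡⟨ cong (f i xor_) (∑-zero (λ k → off _ (punchInᵢ≢i i k))) ⟩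
  f i xor false                 ≡⟨ xor-identityʳ (f i) ⟩
  f i                           ∎

dot≡∑ : ∀ {n} (a w : Vector Bool n) → dot a w ≡ ∑[ j < n ] (a j ∧ w j)
dot≡∑ {zero}  a w = refl
dot≡∑ {suc n} a w = cong (a zero ∧ w zero xor_) (dot≡∑ (a ∘ suc) (w ∘ suc))

dot-congʳ : ∀ {n} (a : Vector Bool n) {v w} → v ≗ w → dot a v ≡ dot a w
dot-congʳ a {v} {w} v≗w = begin
  dot a v                  ≡⟨ dot≡∑ a v ⟩
  ∑[ j < _ ] (a j ∧ v j)   ≡⟨ sum-cong-≗ (cong (a _ ∧_) ∘ v≗w) ⟩
  ∑[ j < _ ] (a j ∧ w j)   ≡⟨ dot≡∑ a w ⟨
  dot a w                  ∎

dot-⊕ʳ : ∀ {n} (a v w : Vector Bool n) → dot a (v ⊕ w) ≡ dot a v xor dot a w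
dot-⊕ʳ {n} a v w = begin
  dot a (v ⊕ w)
    ≡⟨ dot≡∑ a (v ⊕ w) ⟩
  ∑[ j < n ] (a j ∧ (v j xor w j))
    ≡⟨ sum-cong-≗ (λ j → ∧-distribˡ-xor (a j) (v j) (w j)) ⟩
  ∑[ j < n ] ((a j ∧ v j) xor (a j ∧ w j))
    ≡⟨ ∑-distrib-+ (λ j → a j ∧ v j) (λ j → a j ∧ w j) ⟩
  ∑[ j < n ] (a j ∧ v j) xor ∑[ j < n ] (a j ∧ w j)
    ≡⟨ cong₂ _xor_ (dot≡∑ a v) (dot≡∑ a w) ⟨
  dot a v xor dot a w
    ∎

dot-linComb : ∀ {r n} (a : Vector Bool n) (u : Vector Bool r) (z : Fin r → Vector Bool n) →
              dot a (linComb u z) ≡ ∑[ k < r ] (u k ∧ dot a (z k))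
dot-linComb {r} {n} a u z = begin
  dot a (linComb u z)
    ≡⟨ dot≡∑ a (linComb u z) ⟩
  ∑[ j < n ] (a j ∧ ∑[ k < r ] (u k ∧ z k j))
    ≡⟨ sum-cong-≗ (λ j → *-distribˡ-sum (a j) (λ k → u k ∧ z k j)) ⟩
  ∑[ j < n ] ∑[ k < r ] (a j ∧ (u k ∧ z k j))
    ≡⟨ ∑-comm (λ j k → a j ∧ (u k ∧ z k j)) ⟩
  ∑[ k < r ] ∑[ j < n ] (a j ∧ (u k ∧ z k j))
    ≡⟨ sum-cong-≗ (λ k → sum-cong-≗ (λ j → swap (a j) (u k) (z k j))) ⟩
  ∑[ k < r ] ∑[ j < n ] (u k ∧ (a j ∧ z k j))
    ≡⟨ sum-cong-≗ (λ k → *-distribˡ-sum (u k) (λ j → a j ∧ z k j)) ⟨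
  ∑[ k < r ] (u k ∧ ∑[ j < n ] (a j ∧ z k j))
    ≡⟨ sum-cong-≗ (λ k → cong (u k ∧_) (dot≡∑ a (z k))) ⟨
  ∑[ k < r ] (u k ∧ dot a (z k))
    ∎
  where
  swap : ∀ x y w → x ∧ (y ∧ w) ≡ y ∧ (x ∧ w)
  swap x y w = trans (sym (∧-assoc x y w)) (trans (cong (_∧ w) (∧-comm x y)) (∧-assoc y x w))

linComb-⊕ : ∀ {r n} (u u' : Vector Bool r) (z : Fin r → Vector Bool n) →
            linComb (u ⊕ u') z ≗ linComb u z ⊕ linComb u' z
linComb-⊕ u u' z j =
  trans (sum-cong-≗ (λ k → ∧-distribʳ-xor (z k j) (u k) (u' k)))
        (∑-distrib-+ (λ k → u k ∧ z k j) (λ k → u' k ∧ z k j))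

linComb-zero : ∀ {r n} {u : Vector Bool r} (z : Fin r → Vector Bool n) →
               (∀ k → u k ≡ false) → ∀ j → linComb u z j ≡ false
linComb-zero z u≗0 j = ∑-zero (λ k → cong (_∧ z k j) (u≗0 k))

xor-transfer : ∀ {a b c d} → a xor b ≡ c xor d → c ≡ a xor (b xor d)
xor-transfer {a} {b} {c} {d} eq = begin
  c                     ≡⟨ xor-identityʳ c ⟨
  c xor false           ≡⟨ cong (c xor_) (xor-same d) ⟨
  c xor (d xor d)       ≡⟨ xor-assoc c d d ⟨
  (c xor d) xor d       ≡⟨ cong (_xor d) eq ⟨
  (a xor b) xor d       ≡⟨ xor-assoc a b d ⟩
  a xor (b xor d)       ∎

funToFin-cong : ∀ {m n} {f g : Fin m → Fin n} → f ≗ g → funToFin f ≡ funToFin g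
funToFin-cong {zero}  f≗g = refl
funToFin-cong {suc m} f≗g = cong₂ combine (f≗g zero) (funToFin-cong (f≗g ∘ suc))

encode : ∀ {n} → Vector Bool n → Fin (2 ^ n)
encode v = funToFin (Inverse.from 2↔Bool ∘ v)

decode : ∀ {n} → Fin (2 ^ n) → Vector Bool n
decode i = Inverse.to 2↔Bool ∘ finToFun i

decode-encode : ∀ {n} (v : Vector Bool n) → decode (encode v) ≗ v
decode-encode v j = trans (cong (Inverse.to 2↔Bool) (finToFun-funToFin _ j))
                          (Inverse.strictlyInverseˡ 2↔Bool (v j))

encode-decode : ∀ {n} (i : Fin (2 ^ n)) → encode (decode {n} i) ≡ i
encode-decode {n} i = trans (funToFin-cong {n} (Inverse.strictlyInverseʳ 2↔Bool ∘ finToFun i))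
                            (funToFin-finToFin {n} i)

encode-injective : ∀ {n} {v w : Vector Bool n} → encode v ≡ encode w → v ≗ w
encode-injective {v = v} {w} eq j = begin
  v j                 ≡⟨ decode-encode v j ⟨
  decode (encode v) j ≡⟨ cong (λ i → decode i j) eq ⟩
  decode (encode w) j ≡⟨ decode-encode w j ⟩
  w j                 ∎

decode-injective : ∀ {n} {i i' : Fin (2 ^ n)} → decode {n} i ≗ decode i' → i ≡ i'
decode-injective {n} {i} {i'} eq = begin
  i                      ≡⟨ encode-decode {n} i ⟨
  encode (decode {n} i)  ≡⟨ funToFin-cong {n} (cong (Inverse.from 2↔Bool) ∘ eq) ⟩
  encode (decode {n} i') ≡⟨ encode-decode {n} i' ⟩
  i'                     ∎

injective₂⇒*≤ : ∀ {l k m} (f : Fin l → Fin k → Fin m) →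
                (∀ {a b a' b'} → f a b ≡ f a' b' → a ≡ a' × b ≡ b') → l * k ≤ m
injective₂⇒*≤ {l} {k} f inj = injective⇒≤ {f = uncurry f ∘ remQuot k} λ {i} {i'} eq → begin
  i                                  ≡⟨ combine-remQuot {l} k i ⟨
  uncurry combine (remQuot {l} k i)  ≡⟨ cong (uncurry combine) (×-≡,≡→≡ (inj eq)) ⟩
  uncurry combine (remQuot {l} k i') ≡⟨ combine-remQuot {l} k i' ⟩
  i'                                 ∎

*^≤^⇒≤^∸ : ∀ {l m} r n → 1 < m → l * m ^ r ≤ m ^ n → l ≤ m ^ (n ∸ r)
*^≤^⇒≤^∸ {l} {m@(suc _)} r n 1<m le with r ℕ≤? n
... | yes r≤n = *-cancelʳ-≤ l (m ^ (n ∸ r)) (m ^ r) {{m^n≢0 m r}} (subst (l * m ^ r ≤_) m^n≡ le)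
  where
  m^n≡ : m ^ n ≡ m ^ (n ∸ r) * m ^ r
  m^n≡ = trans (cong (m ^_) (sym (m∸n+n≡m r≤n))) (^-distribˡ-+-* m (n ∸ r) r)
*^≤^⇒≤^∸ {zero}      r n 1<m le | no r≰n = z≤n
*^≤^⇒≤^∸ {suc l} {m} r n 1<m le | no r≰n =
  contradiction (≤-trans (m≤m+n (m ^ r) (l * m ^ r)) le) (<⇒≱ (^-monoʳ-< m 1<m (≰⇒> r≰n)))

lookup-≗⇒≡ : ∀ {A : Set} {n} {xs ys : Vec A n} → lookup xs ≗ lookup ys → xs ≡ ys
lookup-≗⇒≡ {xs = xs} {ys} eq = begin
  xs                   ≡⟨ tabulate∘lookup xs ⟨
  tabulate (lookup xs) ≡⟨ tabulate-cong eq ⟩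
  tabulate (lookup ys) ≡⟨ tabulate∘lookup ys ⟩
  ys                   ∎

Unique-lookup-injective : ∀ {A : Set} {xs : List A} → Unique xs →
                          ∀ {i j} → List.lookup xs i ≡ List.lookup xs j → i ≡ j
Unique-lookup-injective (_ ∷ _)    {zero}  {zero}  _  = refl
Unique-lookup-injective (x∉ ∷ _)   {zero}  {suc j} eq = contradiction eq (All.lookup x∉ (∈-lookup j))
Unique-lookup-injective (x∉ ∷ _)   {suc i} {zero}  eq = contradiction (sym eq) (All.lookup x∉ (∈-lookup i))
Unique-lookup-injective (_ ∷ uniq) {suc i} {suc j} eq = cong suc (Unique-lookup-injective uniq eq)

-- StronglyIsolated A unfolds to Σ z (Isolating A z).
Isolating : ∀ {r n} → Matrix r n → (Fin r → Vector Bool n) → Set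
Isolating A z = ∀ i → (∀ k → k ≤ᶠ i → DZero A k (z i))
                    × (dot (row A i) (z i) ≡ true)
                    × (∀ k → k <ᶠ i → dot (row A k) (z i) ≡ false)

Solves : ∀ {r n} → (Fin r → Vector Bool n) → (Fin r → Vec Bool n → Bool) → Vec Bool n → Set
Solves M G x = ∀ i → dot (M i) (lookup x) ≡ G i x

dot-completion : ∀ {r n} {A : Matrix r n} {M} → Completion A M →
                 ∀ {i w} → DZero A i w → dot (M i) w ≡ dot (row A i) w
dot-completion {n = n} {A} {M} completion {i} {w} w-vanishes = begin
  dot (M i) w                  ≡⟨ dot≡∑ (M i) w ⟩
  ∑[ j < n ] (M i j ∧ w j)     ≡⟨ sum-cong-≗ entry ⟩
  ∑[ j < n ] (row A i j ∧ w j) ≡⟨ dot≡∑ (row A i) w ⟨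
  dot (row A i) w              ∎
  where
  entry : ∀ j → M i j ∧ w j ≡ val (A i j) ∧ w j
  entry j with A i j in eq
  ... | 𝟘 = cong (_∧ w j) (proj₁ (completion i j) eq)
  ... | 𝟙 = cong (_∧ w j) (proj₂ (completion i j) eq)
  ... | ⋆ = trans (cong (M i j ∧_) (w-vanishes j eq)) (∧-zeroʳ (M i j))

consistent-invariant : ∀ {r n} {A : Matrix r n} {G} → Consistent A G →
                       ∀ {i w x y} → DZero A i w → lookup y ≗ lookup x ⊕ w → G i y ≡ G i x
consistent-invariant consistent {i} {w} {x} {y} w-vanishes y≗x⊕w =
  consistent i y x λ j star →
    trans (y≗x⊕w j) (trans (cong (lookup x j xor_) (w-vanishes j star)) (xor-identityʳ _))

module _ {r n} {A : Matrix r n} {z : Fin r → Vector Bool n} (isolating : Isolating A z)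
         {M : Fin r → Vector Bool n} {G : Fin r → Vec Bool n → Bool}
         (completion : Completion A M) (consistent : Consistent A G) where

  linComb-vanishes-on-stars : ∀ {u i} → (∀ {k} → k <ᶠ i → u k ≡ false) → DZero A i (linComb u z)
  linComb-vanishes-on-stars {u} {i} below j star = ∑-zero term
    where
    term : ∀ k → u k ∧ z k j ≡ false
    term k with k <? i
    ... | yes k<i = cong (_∧ z k j) (below k<i)
    ... | no  k≮i = trans (cong (u k ∧_) (proj₁ (isolating k) i (≮⇒≥ k≮i) j star)) (∧-zeroʳ (u k))

  row-dot-linComb : ∀ {u i} → u i ≡ true → (∀ {k} → k <ᶠ i → u k ≡ false) →
                    dot (row A i) (linComb u z) ≡ true
  row-dot-linComb {u} {i} uᵢ below = begin
    dot (row A i) (linComb u z)              ≡⟨ dot-linComb (row A i) u z ⟩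
    ∑[ k < r ] (u k ∧ dot (row A i) (z k))   ≡⟨ ∑-single i off ⟩
    u i ∧ dot (row A i) (z i)                ≡⟨ cong₂ _∧_ uᵢ (proj₁ (proj₂ (isolating i))) ⟩
    true                                     ∎
    where
    off : ∀ k → k ≢ i → u k ∧ dot (row A i) (z k) ≡ false
    off k k≢i with <-cmp k i
    ... | tri< k<i _ _ = cong (_∧ dot (row A i) (z k)) (below k<i)
    ... | tri≈ _ k≡i _ = contradiction k≡i k≢i
    ... | tri> _ _ i<k = trans (cong (u k ∧_) (proj₂ (proj₂ (isolating k)) i i<k)) (∧-zeroʳ (u k))

  leading-coefficient-absurd : ∀ {x y u i} → Solves M G x → Solves M G y →
                               lookup y ≗ lookup x ⊕ linComb u z →
                               u i ≡ true → (∀ {k} → k <ᶠ i → u k ≡ false) → ⊥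
  leading-coefficient-absurd {x} {y} {u} {i} x-solves y-solves y≗x⊕w uᵢ below =
    not-¬ refl flips
    where
    w = linComb u z
    w-vanishes = linComb-vanishes-on-stars below
    flips : G i x ≡ not (G i x)
    flips = begin
      G i x                                  ≡⟨ consistent-invariant consistent w-vanishes y≗x⊕w ⟨
      G i y                                  ≡⟨ y-solves i ⟨
      dot (M i) (lookup y)                   ≡⟨ dot-congʳ (M i) y≗x⊕w ⟩
      dot (M i) (lookup x ⊕ w)               ≡⟨ dot-⊕ʳ (M i) (lookup x) w ⟩
      dot (M i) (lookup x) xor dot (M i) w   ≡⟨ cong₂ _xor_ (x-solves i)
                                                  (trans (dot-completion completion w-vanishes)
                                                         (row-dot-linComb uᵢ below)) ⟩
      G i x xor true                         ≡⟨ xor-comm (G i x) true ⟩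
      true xor G i x                         ≡⟨ true-xor (G i x) ⟩
      not (G i x)                            ∎

  translate-coefficients-vanish : ∀ {x y u} → Solves M G x → Solves M G y →
                                  lookup y ≗ lookup x ⊕ linComb u z → ∀ k → u k ≡ false
  translate-coefficients-vanish {x} {y} {u} x-solves y-solves y≗x⊕w =
    WF.All.wfRec <-wellFounded 0ℓ (λ k → u k ≡ false) vanishes
    where
    vanishes : ∀ k → (∀ {j} → j <ᶠ k → u j ≡ false) → u k ≡ false
    vanishes k below with u k in uₖ
    ... | false = refl
    ... | true  = ⊥-elim (leading-coefficient-absurd x-solves y-solves y≗x⊕w uₖ below)

  translates-injective : ∀ {x x' u u'} → Solves M G x → Solves M G x' →
                         lookup x ⊕ linComb u z ≗ lookup x' ⊕ linComb u' z → u ≗ u' × x ≡ x'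
  translates-injective {x} {x'} {u} {u'} x-solves x'-solves eq = u≗u' , lookup-≗⇒≡ x≗x'
    where
    shift : lookup x' ≗ lookup x ⊕ linComb (u ⊕ u') z
    shift j = trans (xor-transfer {lookup x j} {linComb u z j} (eq j))
                    (cong (lookup x j xor_) (sym (linComb-⊕ u u' z j)))
    u⊕u'≗0 = translate-coefficients-vanish x-solves x'-solves shift
    u≗u' : u ≗ u'
    -- in the additive group of GF(2) inversion is the identity
    u≗u' k = x∙y⁻¹≈ε⇒x≈y (u k) (u' k) (u⊕u'≗0 k)
    x≗x' : lookup x ≗ lookup x'
    x≗x' j = sym (begin
      lookup x' j                               ≡⟨ shift j ⟩
      lookup x j xor linComb (u ⊕ u') z j       ≡⟨ cong (lookup x j xor_) (linComb-zero z u⊕u'≗0 j) ⟩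
      lookup x j xor false                      ≡⟨ xor-identityʳ (lookup x j) ⟩
      lookup x j                                ∎)

lemma9 : ∀ (r n : ℕ) (A : Matrix r n) → StronglyIsolated A →
    (L : List (Vec Bool n)) → Unique L → IsSolution A L →
    length L ≤ 2 ^ (n ∸ r)
lemma9 r n A (z , isolating) L unique (M , G , completion , consistent , solutions) =
  *^≤^⇒≤^∸ r n (s≤s (s≤s z≤n)) (injective₂⇒*≤ translate translate-injective)
  where
  point : Fin (length L) → Vec Bool n
  point = List.lookup L

  translate : Fin (length L) → Fin (2 ^ r) → Fin (2 ^ n)
  translate a b = encode (lookup (point a) ⊕ linComb (decode b) z)

  translate-injective : ∀ {a b a' b'} → translate a b ≡ translate a' b' → a ≡ a' × b ≡ b'
  translate-injective {a} {b} {a'} {b'} eq =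
    let u≗u' , x≡x' = translates-injective isolating completion consistent
                        (All.lookup solutions (∈-lookup a)) (All.lookup solutions (∈-lookup a'))
                        (encode-injective eq)
    in Unique-lookup-injective unique x≡x' , decode-injective {r} u≗u'
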